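{- Let $T$ be a tree on a finite set $I$ with $n$ inner vertices, fix a nice total order on $\mathcal V(T)$ and the associated edge-labeling $\lambda$ of $[\hat 0,T]$, and let $\hat 0=x_0\lhd x_1\lhd\cdots\lhd x_n=T$ be the unique maximal chain of $[\hat 0,T]$ with $\lambda(x_{i-1},x_i)=i$ for all $i\in[n]$. For $j\in[n]$ let $\mathsf B_j=\{a \text{ atom of } [\hat 0,T] : \lambda(\hat 0,a)=j\}$. Let $i\in[n]$ and, for each $j\in[i]$, let $a_j\in\mathsf B_j$. Then $x_i=a_1\vee a_2\vee\cdots\vee a_i$.
   Context: A tree on a finite set $I$ is a rooted binary tree (not considered as planar) whose leaves are bijectively labeled by $I$: every vertex is either an inner vertex of valence 3, or a vertex of valence 1 (a leaf or the root); edges are oriented towards the root. A forest on $I$ is a set of trees on pairwise disjoint label sets whose union is $I$; $\mathcal V(F)$ denotes its set of inner vertices. For forests $F,G$ on $I$, $F\le G$ means there is a continuous map from $F$ to $G$ such that: (D1) it is increasing with respect to the orientation towards the root; (D2) it maps inner vertices to inner vertices injectively; (D3) it restricts to the identity of $I$ on leaves; (D4) its restriction to each tree of $F$ is injective. This is a partial order on the set $\operatorname{For}(I)$ of forests on $I$, graded by the number of inner vertices, with minimum $\hat 0$ the forest with no inner vertices; the interval $[\hat 0,T]$ is a lattice. For distinct leaves $i,j$ of $T$, $v_{(i,j)}$ is the inner vertex of $T$ where the paths from $i$ and $j$ to the root meet; for $J\subseteq I$, $\mathcal S(J)=\{v_{(i,j)}: i\ne j\in J\}$. For $F\in[\hat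 0,T]$ whose trees have leaf sets $\pi_1,\dots,\pi_k$, the inner vertices of $F$ are identified with their images in $T$, so that $\mathcal V(F)=\mathcal S(\pi_1)\cup\dots\cup\mathcal S(\pi_k)\subseteq\mathcal V(T)$; if $F\lhd G$ (covering) in $[\hat 0,T]$ there is a unique $v$ with $\mathcal V(G)=\mathcal V(F)\cup\{v\}$. For $v,v'\in\mathcal V(T)$ write $v\preceq v'$ if $v'$ lies on the path between $v$ and the root; a nice total order is a total order on $\mathcal V(T)$ extending $\preceq$, and inner vertices are identified with $1,\dots,n$ increasingly in this order. The edge-labeling $\lambda$ is defined for $F\lhd G$ in $[\hat 0,T]$ by $\mathcal V(G)=\mathcal V(F)\cup\{\lambda(F,G)\}$. The atoms of $[\hat 0,T]$ are the forests whose only non-trivial tree has two leaves $i\ne j$; for such an atom $a$, $\lambda(\hat 0,a)$ is the label of $v_{(i,j)}$. -}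

module Defs where

open import Level using (0ℓ)
open import Data.Nat using (ℕ; zero; suc; _≤_; _∸_)
open import Data.Fin using (Fin; toℕ)
open import Data.List using (List; []; _∷_; _++_)
open import Data.List.Membership.Propositional using (_∈_)
open import Data.List.Relation.Unary.Unique.Propositional using (Unique)
open import Data.Product using (Σ; ∃; _×_; _,_)
open import Data.Sum using (_⊎_)
open import Relation.Nullary using (¬_)
open import Relation.Binary.PropositionalEquality using (_≡_; _≢_)
import Relation.Binary.PropositionalEquality as Eq
open import Data.Empty using (⊥-elim)
open import Data.Unit using (⊤; tt)
open import Relation.Binary.Structures using (IsEquivalence)
open import Function.Bundles using (Bijection; _⤖_; _⇔_)

-- Rooted binary trees with leaves labelled by elements of A.
-- (A tree on I = Fin m is such a tree whose leaf labels enumerate Fin m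
-- bijectively, see IsTreeOn.)  Planarity is irrelevant: we only ever
-- work with one fixed tree T and with its inner vertices / leaf sets.

data BTree (A : Set) : Set where
  leaf : A → BTree A
  node : BTree A → BTree A → BTree A

leaves : ∀ {A} → BTree A → List A
leaves (leaf a)   = a ∷ []
leaves (node l r) = leaves l ++ leaves r

IsTreeOn : (m : ℕ) → BTree (Fin m) → Set
IsTreeOn m T = Unique (leaves T) × (∀ (i : Fin m) → i ∈ leaves T)

-- Inner vertices of a tree (addresses from the root).
data Pos {A : Set} : BTree A → Set where
  here : ∀ {l r} → Pos (node l r)
  goL  : ∀ {l r} → Pos l → Pos (node l r)
  goR  : ∀ {l r} → Pos r → Pos (node l r)

-- v ⪯ v'  :  v' lies on the path between v and the root.
data _⪯_ {A : Set} : {T : BTree A} → Pos T → Pos T → Set where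
  ⪯-root : ∀ {l r} (v : Pos (node l r)) → v ⪯ here
  ⪯-L    : ∀ {l r} {v v' : Pos l} → v ⪯ v' → goL {r = r} v ⪯ goL v'
  ⪯-R    : ∀ {l r} {v v' : Pos r} → v ⪯ v' → goR {l = l} v ⪯ goR v'

-- Meet T i j v  :  v = v_(i,j), the inner vertex where the paths from
-- leaves i and j to the root meet.
data Meet {A : Set} : (T : BTree A) → A → A → Pos T → Set where
  meet-here  : ∀ {l r i j} → i ∈ leaves l → j ∈ leaves r → Meet (node l r) i j here
  meet-here' : ∀ {l r i j} → j ∈ leaves l → i ∈ leaves r → Meet (node l r) i j here
  meet-L     : ∀ {l r i j} {p : Pos l} → Meet l i j p → Meet (node l r) i j (goL p)
  meet-R     : ∀ {l r i j} {p : Pos r} → Meet r i j p → Meet (node l r) i j (goR p)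

-- A nice total order on V(T), given as a bijection with Fin n
-- (inner vertices are identified with 1..n via v ↦ 1 + toℕ (ord v))
-- extending ⪯.
record NiceOrder {m : ℕ} (T : BTree (Fin m)) (n : ℕ) : Set where
  field
    ord  : Pos T ⤖ Fin n
  open Bijection ord public using (to)
  field
    mono : ∀ {v v' : Pos T} → v ⪯ v' → toℕ (to v) ≤ toℕ (to v')
  label : Pos T → ℕ
  label v = suc (toℕ (to v))

-- A forest F ≤ T is determined by the leaf sets π₁,…,πₖ of its trees
-- (each tree of F is T restricted to its leaf set), and a set partition
-- of I arises this way iff the sets S(π_a) are pairwise disjoint
-- (condition (D2)); then V(F) = S(π₁) ∪ … ∪ S(πₖ) ⊆ V(T).  We therefore
-- represent an element of [0̂,T] by the equivalence relation
-- "i and j are leaves of the same tree of F".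

record Forest {m : ℕ} (T : BTree (Fin m)) : Set₁ where
  field
    _~_     : Fin m → Fin m → Set
    isEquiv : IsEquivalence _~_
    -- (D2): distinct trees of F have disjoint sets of inner vertices in T
    disjoint : ∀ {i j k l : Fin m} {v : Pos T} →
               i ~ j → i ≢ j → k ~ l → k ≢ l →
               Meet T i j v → Meet T k l v → i ~ k

open Forest public

module _ {m : ℕ} {T : BTree (Fin m)} where

  _≤F_ : Forest T → Forest T → Set
  F ≤F G = ∀ {i j : Fin m} → _~_ F i j → _~_ G i j

  _≈F_ : Forest T → Forest T → Set
  F ≈F G = F ≤F G × G ≤F F

  _<F_ : Forest T → Forest T → Set
  F <F G = F ≤F G × ¬ (G ≤F F)

  _⋖F_ : Forest T → Forest T → Set₁
  F ⋖F G = F <F G × (∀ (H : Forest T) → F <F H → ¬ (H <F G))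

  V : Forest T → Pos T → Set
  V F v = Σ (Fin m) λ i → Σ (Fin m) λ j → _~_ F i j × i ≢ j × Meet T i j v

  HasLabel : (label : Pos T → ℕ) → Forest T → Forest T → ℕ → Set
  HasLabel label F G k = ∀ (w : Pos T) → V G w ⇔ (V F w ⊎ label w ≡ k)

zeroF : ∀ {m} (T : BTree (Fin m)) → Forest T
zeroF T = record
  { _~_ = _≡_
  ; isEquiv = Eq.isEquivalence
  ; disjoint = λ { Eq.refl i≢j _ _ _ _ → ⊥-elim (i≢j Eq.refl) } }

topF : ∀ {m} (T : BTree (Fin m)) → Forest T
topF T = record
  { _~_ = λ _ _ → ⊤
  ; isEquiv = record { refl = tt ; sym = λ _ → tt ; trans = λ _ _ → tt }
  ; disjoint = λ _ _ _ _ _ _ → tt }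

IsJoinOf : ∀ {m} {T : BTree (Fin m)} → Forest T → ℕ → (ℕ → Forest T) → Set₁
IsJoinOf {T = T} y i a =
  (∀ j → 1 ≤ j → j ≤ i → a j ≤F y) ×
  (∀ (z : Forest T) → (∀ j → 1 ≤ j → j ≤ i → a j ≤F z) → y ≤F z)

{-# OPTIONS --safe #-}
module Submission where

-- The chain x₀ ⋖ ⋯ ⋖ xₙ adds the vertices in the nice order, so V(xᵢ) is the set of vertices
-- with label ≤ i, which is closed under going down in T; and the atom aⱼ has V(aⱼ) = {vⱼ}.
-- Both inequalities then reduce to one fact about an equivalence relation ~ on the leaves:
-- if every vertex below v is v_(r,s) for some r ~ s, then all leaves under v are ~-related
-- (each vertex glues its two subtrees together).  For aⱼ ≤ xᵢ take ~ the relation of xᵢ,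
-- and for xᵢ ≤ z take ~ the relation of z, the vertex of label j being witnessed through aⱼ ≤ z.

open import Defs
open import Data.Nat using (ℕ; zero; suc; _≤_; _∸_; s≤s; z≤n)
open import Data.Nat.Properties
  using (n≤1+n; ≤-trans; ≤-reflexive; ≤-pred; m≤n⇒m≤1+n; m≤n⇒m<n∨m≡n)
open import Data.Fin using (Fin)
open import Data.Fin.Properties using (_≟_)
open import Data.Product using (Σ; _×_; _,_; proj₁; proj₂)
open import Data.Sum using (_⊎_; inj₁; inj₂; [_,_])
open import Data.Empty using (⊥-elim)
open import Data.List.Membership.Propositional using (_∈_)
open import Data.List.Membership.Propositional.Properties using (∈-++⁺ˡ; ∈-++⁺ʳ; ∈-++⁻)
open import Data.List.Relation.Unary.Any using (here)
open import Function using (_∘_; id)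
open import Function.Bundles using (Equivalence; _⇔_; mk⇔)
open import Relation.Nullary using (¬_; yes; no)
open import Relation.Binary.PropositionalEquality using (_≡_; _≢_; refl)
open import Relation.Binary.Structures using (IsEquivalence)

∃-Meet : ∀ {A : Set} (t : BTree A) {p q : A} →
         p ∈ leaves t → q ∈ leaves t → p ≢ q → Σ (Pos t) (Meet t p q)
∃-Meet (leaf a)   (here refl) (here refl) p≢q = ⊥-elim (p≢q refl)
∃-Meet (node l r) p∈ q∈ p≢q with ∈-++⁻ (leaves l) p∈ | ∈-++⁻ (leaves l) q∈
... | inj₁ p∈l | inj₁ q∈l = let v , meet = ∃-Meet l p∈l q∈l p≢q in goL v , meet-L meet
... | inj₂ p∈r | inj₂ q∈r = let v , meet = ∃-Meet r p∈r q∈r p≢q in goR v , meet-R meet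
... | inj₁ p∈l | inj₂ q∈r = here , meet-here p∈l q∈r
... | inj₂ p∈r | inj₁ q∈l = here , meet-here' q∈l p∈r

module _ {A : Set} {_≈_ : A → A → Set} (≈-isEquivalence : IsEquivalence _≈_) where
  open IsEquivalence ≈-isEquivalence renaming (refl to ≈-refl; sym to ≈-sym; trans to ≈-trans)

  Witnessed : (t : BTree A) → Pos t → Set
  Witnessed t v = Σ A λ r → Σ A λ s → r ≈ s × r ≢ s × Meet t r s v

  Witnessed-goL : ∀ {l r} {v : Pos l} → Witnessed (node l r) (goL v) → Witnessed l v
  Witnessed-goL (r , s , r≈s , r≢s , meet-L meet) = r , s , r≈s , r≢s , meet

  Witnessed-goR : ∀ {l r} {v : Pos r} → Witnessed (node l r) (goR v) → Witnessed r v
  Witnessed-goR (r , s , r≈s , r≢s , meet-R meet) = r , s , r≈s , r≢s , meet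

  AllRelated : BTree A → Set
  AllRelated t = ∀ {p q} → p ∈ leaves t → q ∈ leaves t → p ≈ q

  AllRelated-node : ∀ {l r a b} → AllRelated l → AllRelated r →
                    a ∈ leaves l → b ∈ leaves r → a ≈ b → AllRelated (node l r)
  AllRelated-node {l} {r} {a} ≈l ≈r a∈l b∈r a≈b p∈ q∈ =
    ≈-trans (≈a p∈) (≈-sym (≈a q∈))
    where
    ≈a : ∀ {p} → p ∈ leaves (node l r) → p ≈ a
    ≈a p∈ with ∈-++⁻ (leaves l) p∈
    ... | inj₁ p∈l = ≈l p∈l a∈l
    ... | inj₂ p∈r = ≈-trans (≈r p∈r b∈r) (≈-sym a≈b)

  AllRelated-if-Witnessed : ∀ t → (∀ v → Witnessed t v) → AllRelated t
  AllRelated-if-Witnessed (leaf a)   _   (here refl) (here refl) = ≈-refl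
  AllRelated-if-Witnessed (node l r) wit = glue (wit here)
    where
    ≈l : AllRelated l
    ≈l = AllRelated-if-Witnessed l (Witnessed-goL ∘ wit ∘ goL)
    ≈r : AllRelated r
    ≈r = AllRelated-if-Witnessed r (Witnessed-goR ∘ wit ∘ goR)
    glue : Witnessed (node l r) here → AllRelated (node l r)
    glue (a , b , a≈b , _ , meet-here  a∈l b∈r) = AllRelated-node {l} {r} ≈l ≈r a∈l b∈r a≈b
    glue (a , b , a≈b , _ , meet-here' b∈l a∈r) = AllRelated-node {l} {r} ≈l ≈r b∈l a∈r (≈-sym a≈b)

  related-if-Meet : ∀ {t p q v} → Meet t p q v → (∀ u → u ⪯ v → Witnessed t u) → p ≈ q
  related-if-Meet (meet-L meet) wit =
    related-if-Meet meet (λ u u⪯v → Witnessed-goL (wit (goL u) (⪯-L u⪯v)))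
  related-if-Meet (meet-R meet) wit =
    related-if-Meet meet (λ u u⪯v → Witnessed-goR (wit (goR u) (⪯-R u⪯v)))
  related-if-Meet {node l r} (meet-here p∈l q∈r) wit =
    AllRelated-if-Witnessed (node l r) (λ u → wit u (⪯-root u))
      (∈-++⁺ˡ p∈l) (∈-++⁺ʳ (leaves l) q∈r)
  related-if-Meet {node l r} (meet-here' q∈l p∈r) wit =
    AllRelated-if-Witnessed (node l r) (λ u → wit u (⪯-root u))
      (∈-++⁺ʳ (leaves l) p∈r) (∈-++⁺ˡ q∈l)

module _ {m : ℕ} {T : BTree (Fin m)} where

  V-mono : ∀ {F G : Forest T} {w} → F ≤F G → V F w → V G w
  V-mono F≤G (p , q , p~q , p≢q , meet) = p , q , F≤G p~q , p≢q , meet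

  ¬V-zeroF : ∀ {w} → ¬ V (zeroF T) w
  ¬V-zeroF (p , q , p≡q , p≢q , _) = p≢q p≡q

  ≤F-via-Meet : (∀ p → p ∈ leaves T) → {F G : Forest T} →
                (∀ {p q v} → _~_ F p q → p ≢ q → Meet T p q v → _~_ G p q) → F ≤F G
  ≤F-via-Meet all∈ {G = G} related {p} {q} p~q with p ≟ q
  ... | yes refl = IsEquivalence.refl (isEquiv G)
  ... | no p≢q   = related p~q p≢q (proj₂ (∃-Meet T (all∈ p) (all∈ q) p≢q))

  V-atom : ∀ {label : Pos T → ℕ} {a : Forest T} {j} →
           HasLabel label (zeroF T) a j → ∀ w → V a w ⇔ label w ≡ j
  V-atom hasLabel w = mk⇔ ([ ⊥-elim ∘ ¬V-zeroF , id ] ∘ Equivalence.to (hasLabel w))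
                          (Equivalence.from (hasLabel w) ∘ inj₂)

module _ {m n : ℕ} {T : BTree (Fin m)} (N : NiceOrder T n) where
  open NiceOrder N using (label; mono)

  label-mono : ∀ {u v} → u ⪯ v → label u ≤ label v
  label-mono = s≤s ∘ mono

  V-chain : (x : ℕ → Forest T) → x 0 ≤F zeroF T →
            (∀ k → 1 ≤ k → k ≤ n → HasLabel label (x (k ∸ 1)) (x k) k) →
            ∀ k → k ≤ n → ∀ w → V (x k) w ⇔ label w ≤ k
  V-chain x x₀≤0̂ step zero _ w =
    mk⇔ (⊥-elim ∘ ¬V-zeroF ∘ V-mono {F = x 0} {G = zeroF T} x₀≤0̂) λ ()
  V-chain x x₀≤0̂ step (suc k) k<n w = mk⇔
    ([ m≤n⇒m≤1+n ∘ Equivalence.to ih , ≤-reflexive ] ∘ Equivalence.to stepₖ)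
    (Equivalence.from stepₖ ∘ [ inj₁ ∘ Equivalence.from ih ∘ ≤-pred , inj₂ ] ∘ m≤n⇒m<n∨m≡n)
    where
    ih : V (x k) w ⇔ label w ≤ k
    ih = V-chain x x₀≤0̂ step k (≤-trans (n≤1+n k) k<n) w
    stepₖ : V (x (suc k)) w ⇔ (V (x k) w ⊎ label w ≡ suc k)
    stepₖ = step (suc k) (s≤s z≤n) k<n w

mainTheorem10 : ∀ {m : ℕ} (T : BTree (Fin m)) → IsTreeOn m T →
    (n : ℕ) (N : NiceOrder T n) →
    -- the maximal chain 0̂ = x₀ ⋖ x₁ ⋖ ⋯ ⋖ xₙ = T with λ(x_{k-1},x_k) = k
    (x : ℕ → Forest T) → x 0 ≈F zeroF T → x n ≈F topF T →
    (∀ k → 1 ≤ k → k ≤ n →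
      (x (k ∸ 1) ⋖F x k) × HasLabel (NiceOrder.label N) (x (k ∸ 1)) (x k) k) →
    (i : ℕ) → 1 ≤ i → i ≤ n →
    -- a_j ∈ B_j : a_j is an atom of [0̂,T] with λ(0̂,a_j) = j
    (a : ℕ → Forest T) →
    (∀ j → 1 ≤ j → j ≤ i →
      (zeroF T ⋖F a j) × HasLabel (NiceOrder.label N) (zeroF T) (a j) j) →
    IsJoinOf (x i) i a
mainTheorem10 T isTree n N x x₀≈0̂ _ chain i _ i≤n a atoms = aⱼ≤xᵢ , xᵢ≤upper-bound
  where
  open NiceOrder N using (label)

  Vxᵢ : ∀ w → V (x i) w ⇔ label w ≤ i
  Vxᵢ = V-chain N x (proj₁ x₀≈0̂) (λ k 1≤k k≤n → proj₂ (chain k 1≤k k≤n)) i i≤n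

  Vaⱼ : ∀ j → 1 ≤ j → j ≤ i → ∀ w → V (a j) w ⇔ label w ≡ j
  Vaⱼ j 1≤j j≤i = V-atom {label = label} {a = a j} (proj₂ (atoms j 1≤j j≤i))

  ≤i-below : ∀ {u v} → u ⪯ v → label v ≤ i → label u ≤ i
  ≤i-below u⪯v = ≤-trans (label-mono N u⪯v)

  aⱼ≤xᵢ : ∀ j → 1 ≤ j → j ≤ i → a j ≤F x i
  aⱼ≤xᵢ j 1≤j j≤i = ≤F-via-Meet (proj₂ isTree) {a j} {x i} λ {p} {q} {v} p~q p≢q meet →
    let label-v≡j = Equivalence.to (Vaⱼ j 1≤j j≤i v) (p , q , p~q , p≢q , meet)
        label-v≤i = ≤-trans (≤-reflexive label-v≡j) j≤i
    in related-if-Meet (isEquiv (x i)) meet λ u u⪯v →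
         Equivalence.from (Vxᵢ u) (≤i-below u⪯v label-v≤i)

  xᵢ≤upper-bound : ∀ z → (∀ j → 1 ≤ j → j ≤ i → a j ≤F z) → x i ≤F z
  xᵢ≤upper-bound z aⱼ≤z = ≤F-via-Meet (proj₂ isTree) {x i} {z} λ {p} {q} {v} p~q p≢q meet →
    let label-v≤i = Equivalence.to (Vxᵢ v) (p , q , p~q , p≢q , meet)
    in related-if-Meet (isEquiv z) meet λ u u⪯v →
         let label-u≤i = ≤i-below u⪯v label-v≤i
         in V-mono {F = a (label u)} {G = z} (aⱼ≤z (label u) (s≤s z≤n) label-u≤i)
                   (Equivalence.from (Vaⱼ (label u) (s≤s z≤n) label-u≤i u) refl)
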